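{- If $w\in A^*$ satisfies $|alph(w)|>\lceil |w|/2\rceil$, then $c(w)=1$.
   Context: $A$ is a finite alphabet, $alph(w)$ the set of letters occurring in $w$. $\mathcal{L}_{\mathbb{Z}}(A)$ is the free Lie ring: the Lie subalgebra of the free associative algebra $\mathbb{Z}\langle A\rangle$ (with bracket $[P,Q]=PQ-QP$) generated by $A$. For a polynomial $P$ and word $w$, $(P,w)$ is the coefficient of $w$ in $P$. $c(w)$ is the non-negative generator of the ideal $\{(P,w):P\in\mathcal{L}_{\mathbb{Z}}(A)\}$ of $\mathbb{Z}$. -}

module Defs where

open import Data.Nat using (ℕ; ⌈_/2⌉)
open import Data.Fin using (Fin)
open import Data.Fin.Properties using () renaming (_≟_ to _≟ᶠ_)
open import Data.Integer using (ℤ; _+_; _*_; -_; 1ℤ)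
open import Data.Integer.Divisibility using (_∣_)
open import Data.List using (List; []; _∷_; _++_; map; concatMap; length; deduplicate)
open import Data.List.Properties using (≡-dec)
open import Data.Product using (_×_; _,_; ∃)
open import Relation.Binary.PropositionalEquality using (_≡_)
open import Relation.Nullary using (yes; no)
open import Function.Bundles using (_⇔_)

-- The alphabet A is Fin n (an arbitrary finite alphabet); words are lists of letters.
Word : ℕ → Set
Word n = List (Fin n)

_≟ʷ_ : ∀ {n} (u v : Word n) → Relation.Nullary.Dec (u ≡ v)
_≟ʷ_ = ≡-dec _≟ᶠ_

alph : ∀ {n} → Word n → List (Fin n)
alph = deduplicate _≟ᶠ_

-- Elements of ℤ⟨A⟩, represented as finite formal sums  Σ cᵢ wᵢ .
Poly : ℕ → Set
Poly n = List (ℤ × Word n)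

coeff : ∀ {n} → Poly n → Word n → ℤ
coeff [] w = Data.Integer.0ℤ
coeff ((c , u) ∷ P) w with u ≟ʷ w
... | yes _ = c + coeff P w
... | no _  = coeff P w

letter : ∀ {n} → Fin n → Poly n
letter a = (1ℤ , a ∷ []) ∷ []

_⊕_ : ∀ {n} → Poly n → Poly n → Poly n
P ⊕ Q = P ++ Q

⊖_ : ∀ {n} → Poly n → Poly n
⊖ P = map (λ { (c , u) → (- c , u) }) P

_⊗_ : ∀ {n} → Poly n → Poly n → Poly n
P ⊗ Q = concatMap (λ { (c , u) → map (λ { (d , v) → (c * d , u ++ v) }) Q }) P

⁅_,_⁆ : ∀ {n} → Poly n → Poly n → Poly n
⁅ P , Q ⁆ = (P ⊗ Q) ⊕ (⊖ (Q ⊗ P))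

-- Membership in the free Lie ring L_ℤ(A): the Lie subring (ℤ-submodule closed
-- under the bracket) of ℤ⟨A⟩ generated by the letters of A.
data InLie {n : ℕ} : Poly n → Set where
  lie-gen : (a : Fin n) → InLie (letter a)
  lie-0   : InLie []
  lie-add : ∀ {P Q} → InLie P → InLie Q → InLie (P ⊕ Q)
  lie-neg : ∀ {P} → InLie P → InLie (⊖ P)
  lie-br  : ∀ {P Q} → InLie P → InLie Q → InLie ⁅ P , Q ⁆

InCoeffIdeal : ∀ {n} → Word n → ℤ → Set
InCoeffIdeal w k = ∃ λ P → InLie P × coeff P w ≡ k

-- g is the non-negative generator of that ideal, i.e. g = c(w):
-- the ideal equals gℤ.
IsC : ∀ {n} → Word n → ℕ → Set
IsC w g = ∀ (k : ℤ) → InCoeffIdeal w k ⇔ (Data.Integer.+ g ∣ k)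

-- Write d(w) for the number of distinct letters of w; the hypothesis says 2 d(w) ≥ |w| + 2. Since
-- 2 d(w) ≤ |w| + #(letters occurring once), such a rich word has two letters a, b occurring exactly once.
-- By induction on |w| we build a Lie polynomial with coefficient 1 at w whose words all have the length
-- and the letters of w; then 1 lies in the ideal of coefficients. Given such P for w₁ and Q for w₂, the
-- bracket [P, Q] has coefficient 1 at w₁w₂ as soon as no word shaped like w₂ followed by one shaped like
-- w₁ spells w₁w₂, for then QP contributes nothing. A word whose first (last) letter is unique is a right
-- (left) normed bracket of letters; if the last letter differs from the first and repeats, dropping it
-- keeps the word rich. If w begins and ends with the same letter x, cut w between a and b: x lies on both
-- sides, so the two halves together have more than d(w) distinct letters, and when the cut slides one
-- letter at a time from a towards b, at each step either the suffix or the longer prefix is rich.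
module Submission where

open import Defs
open import Data.Bool using (if_then_else_)
open import Data.Empty using (⊥-elim)
open import Data.Fin as Fin using (Fin; punchIn)
open import Data.Fin.Properties using (punchInᵢ≢i) renaming (_≟_ to _≟ᶠ_)
open import Data.Integer as ℤ using (0ℤ; 1ℤ)
import Data.Integer.Properties as ℤ
open import Data.List using (List; []; _∷_; _++_; _∷ʳ_; length; filter; initLast; _∷ʳ′_)
open import Data.List.Properties
  using (++-assoc; ++-identityʳ; ++-cancelˡ; ∷-injective; ∷-injectiveˡ; ∷ʳ-injectiveʳ;
         length-++; length-filter; filter-notAll)
open import Data.List.Membership.Propositional using (_∈_)
open import Data.List.Membership.Propositional.Properties using (∈-deduplicate⁺; ∈-∃++)
open import Data.List.Relation.Unary.All as All using (All; []; _∷_)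
import Data.List.Relation.Unary.All.Properties as All
open import Data.List.Relation.Unary.Any as Any using (here; there)
open import Data.Nat using (ℕ; zero; suc; _+_; _≤_; _<_; _>_; _≤?_; z≤n; s≤s; ⌊_/2⌋; ⌈_/2⌉)
open import Data.Nat.Divisibility using (1∣_)
open import Data.Nat.Induction using (<-wellFounded)
open import Data.Nat.Properties
open import Data.Nat.Tactic.RingSolver using (solve-∀)
open import Data.Product using (∃; ∃₂; _×_; _,_; proj₁; proj₂)
open import Data.Sum as Sum using (_⊎_; inj₁; inj₂)
open import Function using (_∘_)
open import Function.Bundles using (mk⇔)
import Induction.WellFounded as WF
import Relation.Binary.Construct.On as On
open import Relation.Binary.PropositionalEquality
open import Relation.Nullary using (¬_; ¬?; does; yes; no)

open import Algebra.Properties.CommutativeMonoid.Sum +-0-commutativeMonoid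
  using (sum; ∑-distrib-+; sum-remove; sum-replicate-zero)

private variable n : ℕ

-- Sums over Fin n

∑-mono-≤ : ∀ (f g : Fin n → ℕ) → (∀ i → f i ≤ g i) → sum f ≤ sum g
∑-mono-≤ {zero}  f g f≤g = z≤n
∑-mono-≤ {suc n} f g f≤g =
  +-mono-≤ (f≤g Fin.zero) (∑-mono-≤ (f ∘ Fin.suc) (g ∘ Fin.suc) (f≤g ∘ Fin.suc))

∑-mono-< : ∀ (f g : Fin n → ℕ) i → (∀ j → f j ≤ g j) → f i < g i → sum f < sum g
∑-mono-< {suc n} f g i f≤g fi<gi = begin-strict
  sum f                      ≡⟨ sum-remove f ⟩
  f i + sum (f ∘ punchIn i)  <⟨ +-mono-<-≤ fi<gi (∑-mono-≤ _ _ (f≤g ∘ punchIn i)) ⟩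
  g i + sum (g ∘ punchIn i)  ≡⟨ sum-remove g ⟨
  sum g                      ∎
  where open ≤-Reasoning

∑-positive : ∀ (f : Fin n → ℕ) → 0 < sum f → ∃ λ i → 0 < f i
∑-positive {suc n} f 0<∑ with f Fin.zero in f₀
... | suc _ = Fin.zero , subst (0 <_) (sym f₀) (s≤s z≤n)
... | zero  = let i , 0<fi = ∑-positive (f ∘ Fin.suc) 0<∑ in Fin.suc i , 0<fi

∑-two-positive : ∀ (f : Fin n → ℕ) → (∀ i → f i ≤ 1) → 2 ≤ sum f →
                 ∃₂ λ i j → i ≢ j × 0 < f i × 0 < f j
∑-two-positive {suc n} f f≤1 2≤∑ =
  let i , 0<fi = ∑-positive f (≤-trans (s≤s z≤n) 2≤∑)
      j , 0<fj = ∑-positive (f ∘ punchIn i) (+-cancelˡ-≤ 1 1 _ (begin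
        2                          ≤⟨ 2≤∑ ⟩
        sum f                      ≡⟨ sum-remove f ⟩
        f i + sum (f ∘ punchIn i)  ≤⟨ +-monoˡ-≤ _ (f≤1 i) ⟩
        1 + sum (f ∘ punchIn i)    ∎))
  in i , punchIn i j , punchInᵢ≢i i j ∘ sym , 0<fi , 0<fj
  where open ≤-Reasoning

module _ {A : Set} where

  length-∷ʳ : ∀ (u : List A) x → length (u ∷ʳ x) ≡ suc (length u)
  length-∷ʳ u x = trans (length-++ u) (+-comm (length u) 1)

  length-<-++ˡ : ∀ (u v : List A) → 0 < length v → length u < length (u ++ v)
  length-<-++ˡ u v 0<|v| = begin-strict
    length u             ≡⟨ +-identityʳ _ ⟨
    length u + 0         <⟨ +-monoʳ-< (length u) 0<|v| ⟩
    length u + length v  ≡⟨ length-++ u ⟨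
    length (u ++ v)      ∎
    where open ≤-Reasoning

  length-<-++ʳ : ∀ (u v : List A) → 0 < length u → length v < length (u ++ v)
  length-<-++ʳ u v 0<|u| = begin-strict
    length v             <⟨ +-monoˡ-< (length v) 0<|u| ⟩
    length u + length v  ≡⟨ length-++ u ⟨
    length (u ++ v)      ∎
    where open ≤-Reasoning

  ++-cancel-length : ∀ (u w₁ : List A) {v w₂} → length u ≡ length w₁ → u ++ v ≡ w₁ ++ w₂ →
                     u ≡ w₁ × v ≡ w₂
  ++-cancel-length []      []       _   eq = refl , eq
  ++-cancel-length (x ∷ u) (y ∷ w₁) len eq with refl , eq′ ← ∷-injective eq =
    let u≡w₁ , v≡w₂ = ++-cancel-length u w₁ (suc-injective len) eq′ in cong (x ∷_) u≡w₁ , v≡w₂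

  prefix-or-suffix : ∀ (v w₁ : List A) {u w₂} → v ++ u ≡ w₁ ++ w₂ →
                     (∃ λ t → v ≡ w₁ ++ t) ⊎ (∃ λ t → u ≡ t ++ w₂)
  prefix-or-suffix []      w₁       eq = inj₂ (w₁ , eq)
  prefix-or-suffix (x ∷ v) []       eq = inj₁ (x ∷ v , refl)
  prefix-or-suffix (x ∷ v) (y ∷ w₁) eq with refl , eq′ ← ∷-injective eq
    with prefix-or-suffix v w₁ eq′
  ... | inj₁ (t , v≡w₁t) = inj₁ (t , cong (x ∷_) v≡w₁t)
  ... | inj₂ suffix      = inj₂ suffix

  crossing : ∀ (P Q : List A → Set) t → P [] → Q [] →
             (∀ t₁ z t₂ → t ≡ t₁ ++ z ∷ t₂ → P t₁ → Q (z ∷ t₂) ⊎ P (t₁ ∷ʳ z)) →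
             ∃₂ λ t₁ t₂ → t ≡ t₁ ++ t₂ × P t₁ × Q t₂
  crossing P Q []      p q step = [] , [] , refl , p , q
  crossing P Q (z ∷ t) p q step with step [] z t refl p
  ... | inj₁ q′ = [] , z ∷ t , refl , p , q′
  ... | inj₂ p′ =
    let t₁ , t₂ , t≡ , p₁ , q₂ =
          crossing (P ∘ (z ∷_)) Q t p′ q (λ t₁ z′ t₂ → step (z ∷ t₁) z′ t₂ ∘ cong (z ∷_))
    in z ∷ t₁ , t₂ , cong (z ∷_) t≡ , p₁ , q₂

-- Coefficients of polynomials

AllWords : (Word n → Set) → Poly n → Set
AllWords A = All (A ∘ proj₂)

allWords-⊖ : ∀ {A : Word n → Set} P → AllWords A P → AllWords A (⊖ P)
allWords-⊖ P = All.map⁺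

allWords-⊗ : ∀ {A B C : Word n → Set} P Q → AllWords A P → AllWords B Q →
             (∀ {u} → A u → ∀ {v} → B v → C (u ++ v)) → AllWords C (P ⊗ Q)
allWords-⊗ []            Q []        _  AB⇒C = []
allWords-⊗ ((c , u) ∷ P) Q (Au ∷ AP) BQ AB⇒C =
  All.++⁺ (All.map⁺ (All.map (AB⇒C Au) BQ)) (allWords-⊗ P Q AP BQ AB⇒C)

coeff-⊕ : ∀ (P Q : Poly n) w → coeff (P ⊕ Q) w ≡ coeff P w ℤ.+ coeff Q w
coeff-⊕ []            Q w = sym (ℤ.+-identityˡ _)
coeff-⊕ ((c , u) ∷ P) Q w with u ≟ʷ w
... | yes _ = trans (cong (λ z → c ℤ.+ z) (coeff-⊕ P Q w)) (sym (ℤ.+-assoc c _ _))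
... | no _  = coeff-⊕ P Q w

coeff-⊖ : ∀ (P : Poly n) w → coeff (⊖ P) w ≡ ℤ.- coeff P w
coeff-⊖ []            w = refl
coeff-⊖ ((c , u) ∷ P) w with u ≟ʷ w
... | yes _ = trans (cong (λ z → ℤ.- c ℤ.+ z) (coeff-⊖ P w)) (sym (ℤ.neg-distrib-+ c _))
... | no _  = coeff-⊖ P w

coeff-outside : ∀ (P : Poly n) w → AllWords (_≢ w) P → coeff P w ≡ 0ℤ
coeff-outside []            w []          = refl
coeff-outside ((c , u) ∷ P) w (u≢w ∷ u∉P) with u ≟ʷ w
... | yes u≡w = ⊥-elim (u≢w u≡w)
... | no _    = coeff-outside P w u∉P

⊗-∷ˡ : ∀ c (u : Word n) P Q → ((c , u) ∷ P) ⊗ Q ≡ (((c , u) ∷ []) ⊗ Q) ⊕ (P ⊗ Q)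
⊗-∷ˡ c u P Q = cong (_++ P ⊗ Q) (sym (++-identityʳ _))

coeff-∷⊗ : ∀ c (u : Word n) P Q w →
           coeff (((c , u) ∷ P) ⊗ Q) w ≡ coeff (((c , u) ∷ []) ⊗ Q) w ℤ.+ coeff (P ⊗ Q) w
coeff-∷⊗ c u P Q w =
  trans (cong (λ R → coeff R w) (⊗-∷ˡ c u P Q)) (coeff-⊕ (((c , u) ∷ []) ⊗ Q) (P ⊗ Q) w)

coeff-[]⊗-≡ : ∀ c (u : Word n) Q w₂ → coeff (((c , u) ∷ []) ⊗ Q) (u ++ w₂) ≡ c ℤ.* coeff Q w₂
coeff-[]⊗-≡ c u []            w₂ = sym (ℤ.*-zeroʳ c)
coeff-[]⊗-≡ c u ((d , v) ∷ Q) w₂ with (u ++ v) ≟ʷ (u ++ w₂) | v ≟ʷ w₂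
... | yes _   | yes _    =
  trans (cong (λ z → c ℤ.* d ℤ.+ z) (coeff-[]⊗-≡ c u Q w₂)) (sym (ℤ.*-distribˡ-+ c d _))
... | yes uv≡ | no v≢w₂  = ⊥-elim (v≢w₂ (++-cancelˡ u v w₂ uv≡))
... | no uv≢  | yes refl = ⊥-elim (uv≢ refl)
... | no _    | no _     = coeff-[]⊗-≡ c u Q w₂

coeff-[]⊗-≢ : ∀ c (u : Word n) Q w₁ w₂ → length u ≡ length w₁ → u ≢ w₁ →
              coeff (((c , u) ∷ []) ⊗ Q) (w₁ ++ w₂) ≡ 0ℤ
coeff-[]⊗-≢ c u []            w₁ w₂ _   _    = refl
coeff-[]⊗-≢ c u ((d , v) ∷ Q) w₁ w₂ len u≢w₁ with (u ++ v) ≟ʷ (w₁ ++ w₂)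
... | yes uv≡ = ⊥-elim (u≢w₁ (proj₁ (++-cancel-length u w₁ len uv≡)))
... | no _    = coeff-[]⊗-≢ c u Q w₁ w₂ len u≢w₁

coeff-⊗ : ∀ (P Q : Poly n) w₁ w₂ → AllWords (λ u → length u ≡ length w₁) P →
          coeff (P ⊗ Q) (w₁ ++ w₂) ≡ coeff P w₁ ℤ.* coeff Q w₂
coeff-⊗ []            Q w₁ w₂ []           = sym (ℤ.*-zeroˡ (coeff Q w₂))
coeff-⊗ ((c , u) ∷ P) Q w₁ w₂ (len ∷ lens) with u ≟ʷ w₁
... | yes refl = begin
  coeff (((c , u) ∷ P) ⊗ Q) (u ++ w₂)
    ≡⟨ coeff-∷⊗ c u P Q (u ++ w₂) ⟩
  coeff (((c , u) ∷ []) ⊗ Q) (u ++ w₂) ℤ.+ coeff (P ⊗ Q) (u ++ w₂)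
    ≡⟨ cong₂ ℤ._+_ (coeff-[]⊗-≡ c u Q w₂) (coeff-⊗ P Q u w₂ lens) ⟩
  c ℤ.* coeff Q w₂ ℤ.+ coeff P u ℤ.* coeff Q w₂
    ≡⟨ ℤ.*-distribʳ-+ (coeff Q w₂) c (coeff P u) ⟨
  (c ℤ.+ coeff P u) ℤ.* coeff Q w₂
    ∎
  where open ≡-Reasoning
... | no u≢w₁ = begin
  coeff (((c , u) ∷ P) ⊗ Q) (w₁ ++ w₂)
    ≡⟨ coeff-∷⊗ c u P Q (w₁ ++ w₂) ⟩
  coeff (((c , u) ∷ []) ⊗ Q) (w₁ ++ w₂) ℤ.+ coeff (P ⊗ Q) (w₁ ++ w₂)
    ≡⟨ cong₂ ℤ._+_ (coeff-[]⊗-≢ c u Q w₁ w₂ len u≢w₁) (coeff-⊗ P Q w₁ w₂ lens) ⟩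
  0ℤ ℤ.+ coeff P w₁ ℤ.* coeff Q w₂
    ≡⟨ ℤ.+-identityˡ _ ⟩
  coeff P w₁ ℤ.* coeff Q w₂
    ∎
  where open ≡-Reasoning

-- Letter counts

δ : Fin n → Fin n → ℕ
δ a x = if does (a ≟ᶠ x) then 1 else 0

δ-refl : ∀ (x : Fin n) → δ x x ≡ 1
δ-refl x with x ≟ᶠ x
... | yes _   = refl
... | no x≢x = ⊥-elim (x≢x refl)

δ-≢ : ∀ {a x : Fin n} → a ≢ x → δ a x ≡ 0
δ-≢ {a = a} {x} a≢x with a ≟ᶠ x
... | yes a≡x = ⊥-elim (a≢x a≡x)
... | no _    = refl

δ≤1 : ∀ (a x : Fin n) → δ a x ≤ 1
δ≤1 a x with a ≟ᶠ x
... | yes _ = ≤-refl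
... | no _  = z≤n

∑-δ : ∀ (x : Fin n) → sum (λ a → δ a x) ≡ 1
∑-δ {suc n} Fin.zero    = cong suc (sum-replicate-zero n)
∑-δ {suc n} (Fin.suc x) = ∑-δ x

count : Fin n → Word n → ℕ
count a []      = 0
count a (x ∷ w) = δ a x + count a w

count-∷-self : ∀ (x : Fin n) w → 0 < count x (x ∷ w)
count-∷-self x w rewrite δ-refl x = s≤s z≤n

count-∷-≡0 : ∀ (a x : Fin n) w → count a (x ∷ w) ≡ 0 → a ≢ x × count a w ≡ 0
count-∷-≡0 a x w a∉xw =
  (λ { refl → 1+n≢0 (trans (sym (δ-refl a)) (m+n≡0⇒m≡0 _ a∉xw)) }) , m+n≡0⇒n≡0 (δ a x) a∉xw

count-++ : ∀ (a : Fin n) u v → count a (u ++ v) ≡ count a u + count a v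
count-++ a []      v = refl
count-++ a (x ∷ u) v = trans (cong (δ a x +_) (count-++ a u v)) (sym (+-assoc (δ a x) _ _))

count-++-≡0 : ∀ (a : Fin n) u v → count a (u ++ v) ≡ 0 → count a u ≡ 0 × count a v ≡ 0
count-++-≡0 a u v a∉uv = m+n≡0⇒m≡0 _ a∉u+v , m+n≡0⇒n≡0 (count a u) a∉u+v
  where a∉u+v = trans (sym (count-++ a u v)) a∉uv

count-monoˡ : ∀ (a : Fin n) u v → count a u ≤ count a (u ++ v)
count-monoˡ a u v = ≤-trans (m≤m+n _ _) (≤-reflexive (sym (count-++ a u v)))

count-monoʳ : ∀ (a : Fin n) u v → count a v ≤ count a (u ++ v)
count-monoʳ a u v = ≤-trans (m≤n+m _ _) (≤-reflexive (sym (count-++ a u v)))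

once-++ˡ : ∀ (a : Fin n) u v → count a (u ++ v) ≡ 1 → 0 < count a u → count a v ≡ 0
once-++ˡ a u v once a∈u with count a u | count-++ a u v
... | suc k | count≡ = m+n≡0⇒n≡0 k (suc-injective (trans (sym count≡) once))

once-++ʳ : ∀ (a : Fin n) u v → count a (u ++ v) ≡ 1 → 0 < count a v → count a u ≡ 0
once-++ʳ a u v once = once-++ˡ a v u
  (trans (count-++ a v u) (trans (+-comm (count a v) _) (trans (sym (count-++ a u v)) once)))

count≤length : ∀ (a : Fin n) w → count a w ≤ length w
count≤length a []      = z≤n
count≤length a (x ∷ w) = +-mono-≤ (δ≤1 a x) (count≤length a w)

count⇒∈ : ∀ (x : Fin n) w → 0 < count x w → x ∈ w
count⇒∈ x (y ∷ w) 0<count with x ≟ᶠ y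
... | yes x≡y = here x≡y
... | no _    = there (count⇒∈ x w 0<count)

∑-count : ∀ (w : Word n) → sum (λ a → count a w) ≡ length w
∑-count {n} []      = sum-replicate-zero n
∑-count     (x ∷ w) =
  trans (∑-distrib-+ (λ a → δ a x) (λ a → count a w)) (cong₂ _+_ (∑-δ x) (∑-count w))

bordered-∈ : ∀ (x : Fin n) r W₁ W₂ → x ∷ (r ∷ʳ x) ≡ W₁ ++ W₂ → 0 < length W₁ → 0 < length W₂ →
             0 < count x W₁ × 0 < count x W₂
bordered-∈ x r (c ∷ W₁) W₂ eq _ 0<|W₂| with refl ← ∷-injectiveˡ eq with initLast W₂
... | W₂′ ∷ʳ′ y
  with refl ← ∷ʳ-injectiveʳ (x ∷ r) (x ∷ W₁ ++ W₂′) (trans eq (sym (++-assoc (x ∷ W₁) W₂′ (y ∷ [])))) =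
  count-∷-self x W₁ , ≤-trans (count-∷-self x []) (count-monoʳ x W₂′ (x ∷ []))

occurs : ℕ → ℕ
occurs zero    = 0
occurs (suc _) = 1

once : ℕ → ℕ
once 1 = 1
once _ = 0

occurs-≤ : ∀ k → occurs k ≤ k
occurs-≤ zero    = z≤n
occurs-≤ (suc k) = s≤s z≤n

occurs-mono : ∀ {k l} → k ≤ l → occurs k ≤ occurs l
occurs-mono {zero}  _       = z≤n
occurs-mono {suc k} (s≤s _) = ≤-refl

occurs-+ : ∀ k l → occurs (k + l) ≤ occurs k + occurs l
occurs-+ zero    l = ≤-refl
occurs-+ (suc k) l = m≤m+n 1 (occurs l)

occurs-+-< : ∀ {k l} → 0 < k → 0 < l → occurs (k + l) < occurs k + occurs l
occurs-+-< {suc k} {suc l} _ _ = ≤-refl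

occurs-double : ∀ k → occurs k + occurs k ≤ k + once k
occurs-double 0             = z≤n
occurs-double 1             = ≤-refl
occurs-double (suc (suc k)) = s≤s (s≤s z≤n)

once≤1 : ∀ k → once k ≤ 1
once≤1 0             = z≤n
once≤1 1             = ≤-refl
once≤1 (suc (suc k)) = z≤n

once-positive : ∀ {k} → 0 < once k → k ≡ 1
once-positive {1} _ = refl

distinct : Word n → ℕ
distinct w = sum (λ a → occurs (count a w))

singletons : Word n → ℕ
singletons w = sum (λ a → once (count a w))

distinct≤length : ∀ (w : Word n) → distinct w ≤ length w
distinct≤length w = ≤-trans (∑-mono-≤ _ _ (λ a → occurs-≤ (count a w))) (≤-reflexive (∑-count w))

distinct-monoˡ : ∀ (u v : Word n) → distinct u ≤ distinct (u ++ v)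
distinct-monoˡ u v = ∑-mono-≤ _ _ (λ a → occurs-mono (count-monoˡ a u v))

distinct-monoʳ : ∀ (u v : Word n) → distinct v ≤ distinct (u ++ v)
distinct-monoʳ u v = ∑-mono-≤ _ _ (λ a → occurs-mono (count-monoʳ a u v))

distinct-∷-new : ∀ (x : Fin n) w → count x w ≡ 0 → distinct w < distinct (x ∷ w)
distinct-∷-new x w x∉w = ∑-mono-< _ _ x (λ a → occurs-mono (m≤n+m (count a w) (δ a x))) x-new
  where
  x-new : occurs (count x w) < occurs (δ x x + count x w)
  x-new rewrite x∉w | δ-refl x = ≤-refl

distinct-++-< : ∀ (x : Fin n) u v → 0 < count x u → 0 < count x v →
                distinct (u ++ v) < distinct u + distinct v
distinct-++-< x u v x∈u x∈v = begin-strict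
  distinct (u ++ v)                                    <⟨ ∑-mono-< _ _ x occurs-++ occurs-++-x ⟩
  sum (λ a → occurs (count a u) + occurs (count a v))  ≡⟨ ∑-distrib-+ (occurs ∘ (λ a → count a u)) _ ⟩
  distinct u + distinct v                              ∎
  where
  open ≤-Reasoning
  occurs-++ : ∀ a → occurs (count a (u ++ v)) ≤ occurs (count a u) + occurs (count a v)
  occurs-++ a rewrite count-++ a u v = occurs-+ (count a u) (count a v)
  occurs-++-x : occurs (count x (u ++ v)) < occurs (count x u) + occurs (count x v)
  occurs-++-x rewrite count-++ x u v = occurs-+-< x∈u x∈v

double-distinct≤ : ∀ (w : Word n) → distinct w + distinct w ≤ length w + singletons w
double-distinct≤ w = begin
  distinct w + distinct w                  ≡⟨ ∑-distrib-+ (occurs ∘ c) (occurs ∘ c) ⟨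
  sum (λ a → occurs (c a) + occurs (c a))  ≤⟨ ∑-mono-≤ _ _ (occurs-double ∘ c) ⟩
  sum (λ a → c a + once (c a))             ≡⟨ ∑-distrib-+ c (once ∘ c) ⟩
  sum c + singletons w                     ≡⟨ cong (_+ singletons w) (∑-count w) ⟩
  length w + singletons w                  ∎
  where
  open ≤-Reasoning
  c = λ a → count a w

length-alph≤distinct : ∀ (w : Word n) → length (alph w) ≤ distinct w
length-alph≤distinct []      = z≤n
length-alph≤distinct (x ∷ w) with count x w in x-count
... | zero  = begin
  suc (length (filter (¬? ∘ (x ≟ᶠ_)) (alph w)))  ≤⟨ s≤s (length-filter _ (alph w)) ⟩
  suc (length (alph w))                          ≤⟨ s≤s (length-alph≤distinct w) ⟩
  suc (distinct w)                               ≤⟨ distinct-∷-new x w x-count ⟩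
  distinct (x ∷ w)                               ∎
  where open ≤-Reasoning
... | suc _ = begin
  suc (length (filter (¬? ∘ (x ≟ᶠ_)) (alph w)))  ≤⟨ filter-notAll _ (alph w) x-filtered ⟩
  length (alph w)                                ≤⟨ length-alph≤distinct w ⟩
  distinct w                                     ≤⟨ distinct-monoʳ (x ∷ []) w ⟩
  distinct (x ∷ w)                               ∎
  where
  open ≤-Reasoning
  x∈alph : x ∈ alph w
  x∈alph = ∈-deduplicate⁺ _≟ᶠ_ (count⇒∈ x w (subst (0 <_) (sym x-count) (s≤s z≤n)))
  x-filtered = Any.map (λ x≡y x≢y → x≢y x≡y) x∈alph

-- Rich words

Rich : Word n → Set
Rich w = 2 + length w ≤ distinct w + distinct w

rich-of-alph : ∀ (w : Word n) → length (alph w) > ⌈ length w /2⌉ → Rich w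
rich-of-alph w alph> = begin
  2 + m                      ≡⟨ cong (2 +_) (⌊n/2⌋+⌈n/2⌉≡n m) ⟨
  2 + (⌊ m /2⌋ + ⌈ m /2⌉)    ≤⟨ +-monoʳ-≤ 2 (+-monoˡ-≤ ⌈ m /2⌉ (⌊n/2⌋≤⌈n/2⌉ m)) ⟩
  2 + (⌈ m /2⌉ + ⌈ m /2⌉)    ≡⟨ cong suc (+-suc ⌈ m /2⌉ ⌈ m /2⌉) ⟨
  suc ⌈ m /2⌉ + suc ⌈ m /2⌉  ≤⟨ +-mono-≤ d> d> ⟩
  distinct w + distinct w    ∎
  where
  open ≤-Reasoning
  m  = length w
  d> = ≤-trans alph> (length-alph≤distinct w)

¬rich-[] : ¬ Rich {n} []
¬rich-[] {n} rich with () ← ≤-trans rich (+-mono-≤ (distinct≤length {n} []) (distinct≤length {n} []))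

rich⇒two-singletons : ∀ (w : Word n) → Rich w → 2 ≤ singletons w
rich⇒two-singletons w rich = +-cancelˡ-≤ (length w) 2 (singletons w) (begin
  length w + 2             ≡⟨ +-comm (length w) 2 ⟩
  2 + length w             ≤⟨ rich ⟩
  distinct w + distinct w  ≤⟨ double-distinct≤ w ⟩
  length w + singletons w  ∎)
  where open ≤-Reasoning

rich-∷ʳ⁻ : ∀ (w : Word n) y → 0 < count y w → Rich (w ∷ʳ y) → Rich w
rich-∷ʳ⁻ w y y∈w rich = begin
  2 + length w                           ≤⟨ n≤1+n _ ⟩
  3 + length w                           ≡⟨ cong (2 +_) (length-∷ʳ w y) ⟨
  2 + length (w ∷ʳ y)                    ≤⟨ rich ⟩
  distinct (w ∷ʳ y) + distinct (w ∷ʳ y)  ≤⟨ +-mono-≤ distinct≤ distinct≤ ⟩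
  distinct w + distinct w                ∎
  where
  open ≤-Reasoning
  distinct≤ : distinct (w ∷ʳ y) ≤ distinct w
  distinct≤ = +-cancelʳ-≤ 1 _ _ (begin
    distinct (w ∷ʳ y) + 1           ≡⟨ +-comm _ 1 ⟩
    suc (distinct (w ∷ʳ y))         ≤⟨ distinct-++-< y w (y ∷ []) y∈w (count-∷-self y []) ⟩
    distinct w + distinct (y ∷ [])  ≤⟨ +-monoʳ-≤ (distinct w) (distinct≤length (y ∷ [])) ⟩
    distinct w + 1                  ∎)

rich-split : ∀ (x : Fin n) u v z → 0 < count x u → 0 < count x v →
             Rich (u ++ v) → Rich v ⊎ Rich (u ∷ʳ z)
rich-split x u v z x∈u x∈v rich with 2 + length v ≤? distinct v + distinct v
... | yes rich-v = inj₁ rich-v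
... | no ¬rich-v = inj₂ (begin
  2 + length (u ∷ʳ z)                    ≡⟨ cong (2 +_) (length-∷ʳ u z) ⟩
  3 + length u                           ≤⟨ halves (length u) (length v) (distinct (u ++ v)) (distinct u) (distinct v)
                                                   rich′ (distinct-++-< x u v x∈u x∈v) (≰⇒> ¬rich-v) ⟩
  distinct u + distinct u                ≤⟨ +-mono-≤ distinct≤ distinct≤ ⟩
  distinct (u ∷ʳ z) + distinct (u ∷ʳ z)  ∎)
  where
  open ≤-Reasoning
  rich′ : 2 + (length u + length v) ≤ distinct (u ++ v) + distinct (u ++ v)
  rich′ = subst (λ m → 2 + m ≤ distinct (u ++ v) + distinct (u ++ v)) (length-++ u) rich
  distinct≤ : distinct u ≤ distinct (u ∷ʳ z)
  distinct≤ = distinct-monoˡ u (z ∷ [])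
  halves : ∀ a b d d₁ d₂ → 2 + (a + b) ≤ d + d → d < d₁ + d₂ → d₂ + d₂ < 2 + b → 3 + a ≤ d₁ + d₁
  halves a b d d₁ d₂ rich d< d₂< = +-cancelʳ-≤ (1 + b) (3 + a) (d₁ + d₁) (begin
    (3 + a) + (1 + b)      ≡⟨ shuffle₁ a b ⟩
    (2 + (a + b)) + 2      ≤⟨ +-monoˡ-≤ 2 rich ⟩
    (d + d) + 2            ≡⟨ shuffle₂ d ⟩
    suc d + suc d          ≤⟨ +-mono-≤ d< d< ⟩
    (d₁ + d₂) + (d₁ + d₂)  ≡⟨ shuffle₃ d₁ d₂ ⟩
    (d₁ + d₁) + (d₂ + d₂)  ≤⟨ +-monoʳ-≤ (d₁ + d₁) (≤-pred d₂<) ⟩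
    (d₁ + d₁) + (1 + b)    ∎)
    where
    shuffle₁ : ∀ a b → (3 + a) + (1 + b) ≡ (2 + (a + b)) + 2
    shuffle₁ = solve-∀
    shuffle₂ : ∀ d → (d + d) + 2 ≡ suc d + suc d
    shuffle₂ = solve-∀
    shuffle₃ : ∀ d₁ d₂ → (d₁ + d₂) + (d₁ + d₂) ≡ (d₁ + d₁) + (d₂ + d₂)
    shuffle₃ = solve-∀

record OrderedSingletons (w : Word n) : Set where
  constructor ordered
  field
    {a b}    : Fin n
    l₁ l₂ l₃ : Word n
    a-once   : count a w ≡ 1
    b-once   : count b w ≡ 1
    split    : w ≡ l₁ ++ a ∷ l₂ ++ b ∷ l₃

ordered-singletons : ∀ (w : Word n) → Rich w → OrderedSingletons w
ordered-singletons w rich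
  with a , b , a≢b , a-once , b-once ← ∑-two-positive (λ a → once (count a w)) (λ a → once≤1 (count a w))
                                                     (rich⇒two-singletons w rich)
  with l₁ , l , refl ← ∈-∃++ (count⇒∈ a w (≤-reflexive (sym (once-positive a-once))))
  with count b l in b-count
... | suc _ with l₂ , l₃ , refl ← ∈-∃++ (count⇒∈ b l (subst (0 <_) (sym b-count) (s≤s z≤n))) =
  ordered l₁ l₂ l₃ (once-positive a-once) (once-positive b-once) refl
... | zero = b-first (∈-∃++ (count⇒∈ b l₁ b∈l₁))
  where
  b∈l₁ : 0 < count b l₁
  b∈l₁ = ≤-reflexive (sym (begin
    count b l₁                        ≡⟨ +-identityʳ _ ⟨
    count b l₁ + 0                    ≡⟨ cong (count b l₁ +_) (cong₂ _+_ (δ-≢ (a≢b ∘ sym)) b-count) ⟨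
    count b l₁ + (δ b a + count b l)  ≡⟨ count-++ b l₁ (a ∷ l) ⟨
    count b (l₁ ++ a ∷ l)             ≡⟨ once-positive b-once ⟩
    1                                 ∎))
    where open ≡-Reasoning
  b-first : (∃₂ λ m₁ m₂ → l₁ ≡ m₁ ++ b ∷ m₂) → OrderedSingletons (l₁ ++ a ∷ l)
  b-first (m₁ , m₂ , refl) =
    ordered m₁ m₂ l (once-positive b-once) (once-positive a-once) (++-assoc m₁ (b ∷ m₂) (a ∷ l))

-- Lie witnesses

record Fits (w u : Word n) : Set where
  constructor fits
  field
    same-length : length u ≡ length w
    letters-⊆   : ∀ a → count a w ≡ 0 → count a u ≡ 0

fits-++ : ∀ (w₁ w₂ : Word n) {u} → Fits w₁ u → ∀ {v} → Fits w₂ v → Fits (w₁ ++ w₂) (u ++ v)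
fits-++ w₁ w₂ {u} (fits |u| u⊆) {v} (fits |v| v⊆) = fits
  (trans (length-++ u) (trans (cong₂ _+_ |u| |v|) (sym (length-++ w₁))))
  (λ a a∉w → let a∉w₁ , a∉w₂ = count-++-≡0 a w₁ w₂ a∉w in
             trans (count-++ a u v) (cong₂ _+_ (u⊆ a a∉w₁) (v⊆ a a∉w₂)))

fits-++-comm : ∀ (w₁ w₂ : Word n) {u} → Fits (w₂ ++ w₁) u → Fits (w₁ ++ w₂) u
fits-++-comm w₁ w₂ (fits |u| u⊆) = fits
  (trans |u| (trans (length-++ w₂) (trans (+-comm (length w₂) (length w₁)) (sym (length-++ w₁)))))
  (λ a a∉w → u⊆ a (trans (count-++ a w₂ w₁) (trans (+-comm (count a w₂) (count a w₁))
                     (trans (sym (count-++ a w₁ w₂)) a∉w))))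

record Witness (w : Word n) : Set where
  constructor witness
  field
    poly    : Poly n
    lie     : InLie poly
    all-fit : AllWords (Fits w) poly
    coeff≡1 : coeff poly w ≡ 1ℤ

Separated : Word n → Word n → Set
Separated w₁ w₂ = ∀ {v} → Fits w₂ v → ∀ {u} → Fits w₁ u → v ++ u ≢ w₁ ++ w₂

witness-⁅⁆ : ∀ {w₁ w₂ : Word n} → Witness w₁ → Witness w₂ → Separated w₁ w₂ → Witness (w₁ ++ w₂)
witness-⁅⁆ {w₁ = w₁} {w₂} (witness P P-lie P-fit P≡1) (witness Q Q-lie Q-fit Q≡1) sep =
  witness ⁅ P , Q ⁆ (lie-br P-lie Q-lie)
    (All.++⁺ (allWords-⊗ P Q P-fit Q-fit (fits-++ w₁ w₂))
             (allWords-⊖ (Q ⊗ P) (allWords-⊗ Q P Q-fit P-fit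
                                     (λ v-fit u-fit → fits-++-comm w₁ w₂ (fits-++ w₂ w₁ v-fit u-fit)))))
    (begin
      coeff ⁅ P , Q ⁆ (w₁ ++ w₂)                                  ≡⟨ coeff-⊕ (P ⊗ Q) (⊖ (Q ⊗ P)) _ ⟩
      coeff (P ⊗ Q) (w₁ ++ w₂) ℤ.+ coeff (⊖ (Q ⊗ P)) (w₁ ++ w₂)  ≡⟨ cong₂ ℤ._+_ PQ≡1 QP≡0 ⟩
      1ℤ ℤ.+ ℤ.- 0ℤ                                               ≡⟨⟩
      1ℤ                                                          ∎)
  where
  open ≡-Reasoning
  PQ≡1 : coeff (P ⊗ Q) (w₁ ++ w₂) ≡ 1ℤ
  PQ≡1 = trans (coeff-⊗ P Q w₁ w₂ (All.map Fits.same-length P-fit)) (cong₂ ℤ._*_ P≡1 Q≡1)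
  QP≡0 : coeff (⊖ (Q ⊗ P)) (w₁ ++ w₂) ≡ ℤ.- 0ℤ
  QP≡0 = trans (coeff-⊖ (Q ⊗ P) _) (cong ℤ.-_ (coeff-outside (Q ⊗ P) _ (allWords-⊗ Q P Q-fit P-fit sep)))

witness-letter : ∀ (x : Fin n) → Witness (x ∷ [])
witness-letter x = witness (letter x) (lie-gen x) (fits refl (λ _ a∉x → a∉x) ∷ []) coeff-letter
  where
  coeff-letter : coeff (letter x) (x ∷ []) ≡ 1ℤ
  coeff-letter with (x ∷ []) ≟ʷ (x ∷ [])
  ... | yes _   = refl
  ... | no x≢x = ⊥-elim (x≢x refl)

separated-by-letters : ∀ (w₁ w₂ : Word n) a b → 0 < count a w₁ → count a w₂ ≡ 0 →
                       0 < count b w₂ → count b w₁ ≡ 0 → Separated w₁ w₂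
separated-by-letters w₁ w₂ a b a∈w₁ a∉w₂ b∈w₂ b∉w₁ {v} (fits _ v⊆) (fits _ u⊆) eq
  with prefix-or-suffix v w₁ eq
... | inj₁ (t , refl) = <⇒≢ (≤-trans a∈w₁ (count-monoˡ a w₁ t)) (sym (v⊆ a a∉w₂))
... | inj₂ (t , refl) = <⇒≢ (≤-trans b∈w₂ (count-monoʳ b t w₂)) (sym (u⊆ b b∉w₁))

separated-∷ʳ : ∀ (x : Fin n) r z → x ≢ z → Separated (x ∷ r) (z ∷ [])
separated-∷ʳ x r z x≢z {v₀ ∷ []} (fits _ v⊆) _ eq with refl ← ∷-injectiveˡ eq =
  <⇒≢ (count-∷-self x []) (sym (v⊆ x (cong (_+ 0) (δ-≢ x≢z))))

separated-∷ : ∀ (z : Fin n) h y → y ≢ z → Separated (z ∷ []) (h ∷ʳ y)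
separated-∷ z h y y≢z {v} _ {u₀ ∷ []} (fits _ u⊆) eq with refl ← ∷ʳ-injectiveʳ v (z ∷ h) eq =
  <⇒≢ (count-∷-self y []) (sym (u⊆ y (cong (_+ 0) (δ-≢ y≢z))))

witness-∷-fresh : ∀ (x : Fin n) h → count x h ≡ 0 → Witness (x ∷ h)
witness-∷-fresh x h x∉h = extend [] h x∉h (witness-letter x)
  where
  extend : ∀ p t → count x t ≡ 0 → Witness (x ∷ p) → Witness (x ∷ p ++ t)
  extend p []      _    wit = subst (Witness ∘ (x ∷_)) (sym (++-identityʳ p)) wit
  extend p (z ∷ t) x∉zt wit =
    let x≢z , x∉t = count-∷-≡0 x z t x∉zt in
    subst (Witness ∘ (x ∷_)) (++-assoc p (z ∷ []) t)
          (extend (p ∷ʳ z) t x∉t (witness-⁅⁆ wit (witness-letter z) (separated-∷ʳ x p z x≢z)))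

witness-∷ʳ-fresh : ∀ (h : Word n) y → count y h ≡ 0 → Witness (h ∷ʳ y)
witness-∷ʳ-fresh []      y _    = witness-letter y
witness-∷ʳ-fresh (z ∷ h) y y∉zh =
  let y≢z , y∉h = count-∷-≡0 y z h y∉zh in
  witness-⁅⁆ (witness-letter z) (witness-∷ʳ-fresh h y y∉h) (separated-∷ z h y y≢z)

module Cut {n} {w : Word n} (s : OrderedSingletons w) where
  open OrderedSingletons s

  prefix suffix : Word n → Word n
  prefix t₁ = l₁ ++ a ∷ t₁
  suffix t₂ = t₂ ++ b ∷ l₃

  module At t₁ t₂ (l₂≡ : l₂ ≡ t₁ ++ t₂) where
    w≡ : w ≡ prefix t₁ ++ suffix t₂
    w≡ = begin
      w                               ≡⟨ split ⟩
      l₁ ++ a ∷ l₂ ++ b ∷ l₃          ≡⟨ cong (λ l → l₁ ++ a ∷ l ++ b ∷ l₃) l₂≡ ⟩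
      l₁ ++ a ∷ (t₁ ++ t₂) ++ b ∷ l₃  ≡⟨ cong (λ l → l₁ ++ a ∷ l) (++-assoc t₁ t₂ (b ∷ l₃)) ⟩
      l₁ ++ (a ∷ t₁) ++ suffix t₂     ≡⟨ ++-assoc l₁ (a ∷ t₁) (suffix t₂) ⟨
      prefix t₁ ++ suffix t₂          ∎
      where open ≡-Reasoning

    a∈prefix : 0 < count a (prefix t₁)
    a∈prefix = ≤-trans (count-∷-self a t₁) (count-monoʳ a l₁ (a ∷ t₁))

    b∈suffix : 0 < count b (suffix t₂)
    b∈suffix = ≤-trans (count-∷-self b l₃) (count-monoʳ b t₂ (b ∷ l₃))

    separated : Separated (prefix t₁) (suffix t₂)
    separated = separated-by-letters (prefix t₁) (suffix t₂) a b
      a∈prefix (once-++ˡ a (prefix t₁) (suffix t₂) (subst (λ v → count a v ≡ 1) w≡ a-once) a∈prefix)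
      b∈suffix (once-++ʳ b (prefix t₁) (suffix t₂) (subst (λ v → count b v ≡ 1) w≡ b-once) b∈suffix)

    0<|prefix| : 0 < length (prefix t₁)
    0<|prefix| = ≤-trans a∈prefix (count≤length a (prefix t₁))

    0<|suffix| : 0 < length (suffix t₂)
    0<|suffix| = ≤-trans b∈suffix (count≤length b (suffix t₂))

    prefix-shorter : length (prefix t₁) < length w
    prefix-shorter = subst (λ v → length (prefix t₁) < length v) (sym w≡)
                       (length-<-++ˡ (prefix t₁) (suffix t₂) 0<|suffix|)

    suffix-shorter : length (suffix t₂) < length w
    suffix-shorter = subst (λ v → length (suffix t₂) < length v) (sym w≡)
                       (length-<-++ʳ (prefix t₁) (suffix t₂) 0<|prefix|)

  witness-prefix-[] : Witness (prefix [])
  witness-prefix-[] = witness-∷ʳ-fresh l₁ a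
    (once-++ʳ a l₁ _ (subst (λ v → count a v ≡ 1) split a-once) (count-∷-self a (l₂ ++ b ∷ l₃)))

  witness-suffix-[] : Witness (suffix [])
  witness-suffix-[] = witness-∷-fresh b l₃
    (once-++ˡ b (prefix l₂ ∷ʳ b) l₃ (subst (λ v → count b v ≡ 1) w≡ b-once)
              (≤-trans (count-∷-self b []) (count-monoʳ b (prefix l₂) (b ∷ []))))
    where
    w≡ : w ≡ (prefix l₂ ∷ʳ b) ++ l₃
    w≡ = trans (At.w≡ l₂ [] (sym (++-identityʳ l₂))) (sym (++-assoc (prefix l₂) (b ∷ []) l₃))

witness-bordered : ∀ (x : Fin n) r → Rich (x ∷ (r ∷ʳ x)) →
                   (∀ {W} → length W < length (x ∷ (r ∷ʳ x)) → Rich W → Witness W) →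
                   Witness (x ∷ (r ∷ʳ x))
witness-bordered x r rich rec with ordered-singletons (x ∷ (r ∷ʳ x)) rich
... | s =
  let t₁ , t₂ , l₂≡ , wit₁ , wit₂ =
        crossing (Witness ∘ prefix) (Witness ∘ suffix) l₂ witness-prefix-[] witness-suffix-[] step
      open At t₁ t₂ l₂≡
  in subst Witness (sym w≡) (witness-⁅⁆ wit₁ wit₂ separated)
  where
  open OrderedSingletons s using (a; l₁; l₂)
  open Cut s

  step : ∀ t₁ z t₂ → l₂ ≡ t₁ ++ z ∷ t₂ → Witness (prefix t₁) →
         Witness (suffix (z ∷ t₂)) ⊎ Witness (prefix (t₁ ∷ʳ z))
  step t₁ z t₂ l₂≡ _ =
    let x∈prefix , x∈suffix = bordered-∈ x r _ _ w≡ 0<|prefix| 0<|suffix| in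
    Sum.map (rec suffix-shorter) (rec (At.prefix-shorter (t₁ ∷ʳ z) t₂ l₂≡′) ∘ subst Rich prefix-∷ʳ)
            (rich-split x (prefix t₁) (suffix (z ∷ t₂)) z x∈prefix x∈suffix (subst Rich w≡ rich))
    where
    open At t₁ (z ∷ t₂) l₂≡
    l₂≡′ : l₂ ≡ (t₁ ∷ʳ z) ++ t₂
    l₂≡′ = trans l₂≡ (sym (++-assoc t₁ (z ∷ []) t₂))
    prefix-∷ʳ : prefix t₁ ∷ʳ z ≡ prefix (t₁ ∷ʳ z)
    prefix-∷ʳ = ++-assoc l₁ (a ∷ t₁) (z ∷ [])

rich⇒witness : ∀ (w : Word n) → Rich w → Witness w
rich⇒witness {n} = wfRec (λ w → Rich w → Witness w) step
  where
  open WF.All (On.wellFounded length <-wellFounded) _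
  step : ∀ w → (∀ {W} → length W < length w → Rich W → Witness W) → Rich w → Witness w
  step []      _   rich = ⊥-elim (¬rich-[] {n} rich)
  step (x ∷ r) rec rich with initLast r
  ... | []       = witness-letter x
  ... | r′ ∷ʳ′ y with count x (r′ ∷ʳ y) in x-count | count y (x ∷ r′) in y-count
  ...   | zero  | _     = witness-∷-fresh x (r′ ∷ʳ y) x-count
  ...   | suc _ | zero  = witness-∷ʳ-fresh (x ∷ r′) y y-count
  ...   | suc _ | suc _ with x ≟ᶠ y
  ...     | yes refl = witness-bordered x r′ rich rec
  ...     | no x≢y  =
    witness-⁅⁆ (rec (length-<-++ˡ (x ∷ r′) (y ∷ []) (s≤s z≤n)) (rich-∷ʳ⁻ (x ∷ r′) y y∈ rich))
               (witness-letter y) (separated-∷ʳ x r′ y x≢y)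
    where
    y∈ : 0 < count y (x ∷ r′)
    y∈ = subst (0 <_) (sym y-count) (s≤s z≤n)

_·_ : ℕ → Poly n → Poly n
zero  · P = []
suc m · P = P ⊕ (m · P)

inLie-· : ∀ m {P : Poly n} → InLie P → InLie (m · P)
inLie-· zero    P-lie = lie-0
inLie-· (suc m) P-lie = lie-add P-lie (inLie-· m P-lie)

coeff-· : ∀ m (P : Poly n) w → coeff (m · P) w ≡ ℤ.+ m ℤ.* coeff P w
coeff-· zero    P w = sym (ℤ.*-zeroˡ (coeff P w))
coeff-· (suc m) P w = begin
  coeff (P ⊕ (m · P)) w              ≡⟨ coeff-⊕ P (m · P) w ⟩
  coeff P w ℤ.+ coeff (m · P) w      ≡⟨ cong (λ c → coeff P w ℤ.+ c) (coeff-· m P w) ⟩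
  coeff P w ℤ.+ ℤ.+ m ℤ.* coeff P w  ≡⟨ ℤ.suc-* (ℤ.+ m) (coeff P w) ⟨
  ℤ.+ suc m ℤ.* coeff P w            ∎
  where open ≡-Reasoning

inCoeffIdeal-* : ∀ (w : Word n) {k} → InCoeffIdeal w k → ∀ z → InCoeffIdeal w (z ℤ.* k)
inCoeffIdeal-* w (P , P-lie , refl) (ℤ.+ m)    = m · P , inLie-· m P-lie , coeff-· m P w
inCoeffIdeal-* w (P , P-lie , refl) ℤ.-[1+ m ] =
  ⊖ (suc m · P) , lie-neg (inLie-· (suc m) P-lie) ,
  trans (coeff-⊖ (suc m · P) w)
        (trans (cong ℤ.-_ (coeff-· (suc m) P w)) (ℤ.neg-distribˡ-* (ℤ.+ suc m) (coeff P w)))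

corollary3p4 : ∀ (n : ℕ) (w : Word n) → length (alph w) > ⌈ length w /2⌉ → IsC w 1
corollary3p4 n w alph> k =
  mk⇔ (λ _ → 1∣ ℤ.∣ k ∣) (λ _ → subst (InCoeffIdeal w) (ℤ.*-identityʳ k) (inCoeffIdeal-* w ∋1 k))
  where
  open Witness (rich⇒witness w (rich-of-alph w alph>))
  ∋1 : InCoeffIdeal w 1ℤ
  ∋1 = poly , lie , coeff≡1
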